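{- For every integer $n\ge 2$, the $1$-extra connectivity of the $3$-ary $n$-cube satisfies $\kappa_1(Q_n^3)=4n-3$.
   Context: The $3$-ary $n$-cube $Q_n^3$ is the graph whose vertices are the strings $x_1x_2\cdots x_n$ with each $x_i\in\{0,1,2\}$, two vertices $x,y$ being adjacent iff their Lee distance is $1$, where the Lee distance is $D_L(x,y)=\sum_{i=1}^n |(x_i-y_i)\bmod 3|$ with $|a|=\min(a,3-a)$ for $a\in\{0,1,2\}$. Equivalently, $x,y$ are adjacent iff they differ in exactly one coordinate. For a graph $G$ and integer $h\ge 0$, a vertex set $S\subseteq V(G)$ is an $h$-extra vertex-cut if $G-S$ is disconnected and every component of $G-S$ has more than $h$ vertices; the $h$-extra connectivity $\kappa_h(G)$ is the minimum cardinality of an $h$-extra vertex-cut. -}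

module Defs where

open import Data.Nat using (ℕ; zero; suc; _+_; _*_; _∸_; _<_; _⊓_; _%_)
open import Data.Fin using (Fin; toℕ)
open import Data.Vec using (Vec; []; _∷_)
open import Data.List using (List; length)
open import Data.List.Membership.Propositional using (_∈_; _∉_)
open import Data.List.Relation.Unary.All using (All)
open import Data.List.Relation.Unary.Unique.Propositional using (Unique)
open import Data.Product using (Σ; _×_; ∃-syntax)
open import Relation.Binary.PropositionalEquality using (_≡_)
open import Relation.Nullary using (¬_)

Vertex : ℕ → Set
Vertex n = Vec (Fin 3) n

leeAbs : ℕ → ℕ
leeAbs a = a ⊓ (3 ∸ a)

-- (x - y) mod 3, computed as (x + 2y) mod 3
diffMod3 : Fin 3 → Fin 3 → ℕ
diffMod3 x y = (toℕ x + 2 * toℕ y) % 3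

leeDist : ∀ {n} → Vertex n → Vertex n → ℕ
leeDist [] [] = 0
leeDist (x ∷ xs) (y ∷ ys) = leeAbs (diffMod3 x y) + leeDist xs ys

Adj : ∀ {n} → Vertex n → Vertex n → Set
Adj x y = leeDist x y ≡ 1

data Reach {n : ℕ} (S : List (Vertex n)) (u : Vertex n) : Vertex n → Set where
  here : u ∉ S → Reach S u u
  step : ∀ {w v} → Reach S u w → Adj w v → v ∉ S → Reach S u v

Disconnected : ∀ {n} → List (Vertex n) → Set
Disconnected {n} S =
  Σ (Vertex n) λ u → Σ (Vertex n) λ v → u ∉ S × v ∉ S × ¬ Reach S u v

BigComponent : ∀ {n} → ℕ → List (Vertex n) → Vertex n → Set
BigComponent {n} h S u =
  Σ (List (Vertex n)) λ C → Unique C × All (Reach S u) C × h < length C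

IsExtraCut : (n h : ℕ) → List (Vertex n) → Set
IsExtraCut n h S =
  Unique S × Disconnected S × (∀ u → u ∉ S → BigComponent h S u)

ExtraConnectivityIs : (n h k : ℕ) → Set
ExtraConnectivityIs n h k =
  (Σ (List (Vertex n)) λ S → IsExtraCut n h S × length S ≡ k)
  × (∀ S → IsExtraCut n h S → k Data.Nat.≤ length S)

-- Upper bound: removing the 4n − 3 neighbours of the edge {0⋯0, 10⋯0} isolates that edge, while every
-- other vertex keeps a neighbour outside the cut.
--
-- Lower bound: a 1-extra cut S, together with a vertex u outside it, labels each vertex cut (in S), left
-- (reachable from u) or right (the rest). No edge joins left and right, both sides occur, and no left or
-- right vertex is isolated within its side. Split Q_n^3 by the first coordinate into three layers, copies
-- of Q_{n-1}^3. A layer meeting both sides contains 2(n − 1) cut vertices by the classical bound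
-- κ(Q_m^3) ≥ 2m, itself proved by the same decomposition. Between a layer without right and a layer
-- without left vertices every pair of corresponding vertices contains a cut vertex, giving 3^{n-1} of
-- them. The remaining cut vertices come from the third layer; when all vertices of one side lie in a
-- single layer, they come instead from the closed neighbourhood of an edge of that side, which exists
-- because no vertex is isolated within its side.
module Submission where

open import Defs
open import Data.Bool using (Bool; true; false; _∨_; if_then_else_)
open import Data.Bool.Properties using (∨-zeroʳ)
open import Data.Empty using (⊥; ⊥-elim)
open import Data.Fin using (Fin)
open import Data.Fin.Patterns using (0F; 1F; 2F)
import Data.Fin.Properties as Fin
import Data.List as List
open List using (List; []; _∷_; length)
open import Data.List.Membership.Propositional using (_∈_; _∉_)
open import Data.List.Membership.Propositional.Properties using (∈-map⁺; ∈-map⁻; ∈-++⁺ˡ; ∈-++⁺ʳ; ∈-++⁻)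
open import Data.List.Properties using (length-map; length-++)
open import Data.List.Relation.Unary.All using ([]; _∷_)
open import Data.List.Relation.Unary.All.Properties using (¬Any⇒All¬)
open import Data.List.Relation.Unary.AllPairs using ([]; _∷_)
open import Data.List.Relation.Unary.Any using (here; there)
import Data.List.Relation.Unary.Any as Any
open import Data.List.Relation.Unary.Unique.Propositional using (Unique)
import Data.List.Relation.Unary.Unique.Propositional.Properties as Unique
open import Data.Nat using (ℕ; zero; suc; _+_; _*_; _∸_; _≤_; _^_; z≤n; s≤s; s≤s⁻¹; _≤?_)
open import Data.Nat.Properties
  using (≤-refl; ≤-trans; ≤-reflexive; +-mono-≤; +-monoˡ-≤; +-monoʳ-≤; *-monoʳ-≤; m≤m+n; +-assoc; +-comm;
         suc-injective; m+n∸m≡n; +-commutativeSemigroup; module ≤-Reasoning)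
open import Algebra.Properties.CommutativeSemigroup +-commutativeSemigroup using (xy∙z≈yx∙z; xy∙z≈xz∙y)
open import Data.Nat.Tactic.RingSolver using (solve-∀; solve)
open import Data.Product using (∃; ∃₂; ∃-syntax; _×_; _,_; proj₂; curry)
open import Data.Sum using (_⊎_; inj₁; inj₂; [_,_]; [_,_]′)
import Data.Sum
open import Data.Vec using ([]; _∷_; replicate)
open import Data.Vec.Properties using (∷-injectiveʳ)
import Data.Vec.Properties as Vec
open import Function using (_∘_)
open import Relation.Binary.Definitions using (DecidableEquality)
open import Relation.Binary.PropositionalEquality using (_≡_; _≢_; refl; sym; trans; cong; cong₂; module ≡-Reasoning)
open import Relation.Nullary using (¬_; Dec; yes; no; does)
open import Relation.Nullary.Decidable using (map′; decidable-stable; ¬¬-excluded-middle)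

digitDist : Fin 3 → Fin 3 → ℕ
digitDist x y = leeAbs (diffMod3 x y)

digitDist-refl : ∀ x → digitDist x x ≡ 0
digitDist-refl 0F = refl
digitDist-refl 1F = refl
digitDist-refl 2F = refl

digitDist-≢ : ∀ {x y} → x ≢ y → digitDist x y ≡ 1
digitDist-≢ {0F} {0F} x≢y = ⊥-elim (x≢y refl)
digitDist-≢ {0F} {1F} _ = refl
digitDist-≢ {0F} {2F} _ = refl
digitDist-≢ {1F} {0F} _ = refl
digitDist-≢ {1F} {1F} x≢y = ⊥-elim (x≢y refl)
digitDist-≢ {1F} {2F} _ = refl
digitDist-≢ {2F} {0F} _ = refl
digitDist-≢ {2F} {1F} _ = refl
digitDist-≢ {2F} {2F} x≢y = ⊥-elim (x≢y refl)

leeDist-refl : ∀ {n} (t : Vertex n) → leeDist t t ≡ 0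
leeDist-refl [] = refl
leeDist-refl (x ∷ t) rewrite digitDist-refl x = leeDist-refl t

leeDist≡0⇒≡ : ∀ {n} (s t : Vertex n) → leeDist s t ≡ 0 → s ≡ t
leeDist≡0⇒≡ [] [] _ = refl
leeDist≡0⇒≡ (x ∷ s) (y ∷ t) d≡0 with x Fin.≟ y
... | yes refl rewrite digitDist-refl x = cong (x ∷_) (leeDist≡0⇒≡ s t d≡0)
... | no x≢y rewrite digitDist-≢ x≢y with () ← d≡0

infix 4 _~_

data _~_ : ∀ {n} → Vertex n → Vertex n → Set where
  head≢ : ∀ {n x y} {t : Vertex n} → x ≢ y → x ∷ t ~ y ∷ t
  tail~ : ∀ {n x} {s t : Vertex n} → s ~ t → x ∷ s ~ x ∷ t

~-sym : ∀ {n} {s t : Vertex n} → s ~ t → t ~ s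
~-sym (head≢ x≢y) = head≢ (x≢y ∘ sym)
~-sym (tail~ s~t) = tail~ (~-sym s~t)

~-irrefl : ∀ {n} {t : Vertex n} → ¬ t ~ t
~-irrefl (head≢ x≢x) = x≢x refl
~-irrefl (tail~ t~t) = ~-irrefl t~t

~⇒≢ : ∀ {n} {s t : Vertex n} → s ~ t → s ≢ t
~⇒≢ s~t refl = ~-irrefl s~t

Adj⇒~ : ∀ {n} (s t : Vertex n) → Adj s t → s ~ t
Adj⇒~ [] [] ()
Adj⇒~ (x ∷ s) (y ∷ t) d≡1 with x Fin.≟ y
... | yes refl rewrite digitDist-refl x = tail~ (Adj⇒~ s t d≡1)
... | no x≢y rewrite digitDist-≢ x≢y with refl ← leeDist≡0⇒≡ s t (suc-injective d≡1) = head≢ x≢y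

~⇒Adj : ∀ {n} {s t : Vertex n} → s ~ t → Adj s t
~⇒Adj (head≢ {t = t} x≢y) rewrite digitDist-≢ x≢y | leeDist-refl t = refl
~⇒Adj (tail~ {x = x} s~t) rewrite digitDist-refl x = ~⇒Adj s~t

data Enum3 : Fin 3 → Fin 3 → Fin 3 → Set where
  e012 : Enum3 0F 1F 2F
  e021 : Enum3 0F 2F 1F
  e102 : Enum3 1F 0F 2F
  e120 : Enum3 1F 2F 0F
  e201 : Enum3 2F 0F 1F
  e210 : Enum3 2F 1F 0F

enum3-swap₁₂ : ∀ {i j k} → Enum3 i j k → Enum3 j i k
enum3-swap₁₂ e012 = e102
enum3-swap₁₂ e021 = e201
enum3-swap₁₂ e102 = e012
enum3-swap₁₂ e120 = e210
enum3-swap₁₂ e201 = e021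
enum3-swap₁₂ e210 = e120

enum3-swap₂₃ : ∀ {i j k} → Enum3 i j k → Enum3 i k j
enum3-swap₂₃ e012 = e021
enum3-swap₂₃ e021 = e012
enum3-swap₂₃ e102 = e120
enum3-swap₂₃ e120 = e102
enum3-swap₂₃ e201 = e210
enum3-swap₂₃ e210 = e201

enum3-≢ : ∀ {i j k} → Enum3 i j k → i ≢ j
enum3-≢ e012 ()
enum3-≢ e021 ()
enum3-≢ e102 ()
enum3-≢ e120 ()
enum3-≢ e201 ()
enum3-≢ e210 ()

enum3-≢₁₃ : ∀ {i j k} → Enum3 i j k → i ≢ k
enum3-≢₁₃ = enum3-≢ ∘ enum3-swap₂₃

enum3-≢₂₃ : ∀ {i j k} → Enum3 i j k → j ≢ k
enum3-≢₂₃ = enum3-≢ ∘ enum3-swap₂₃ ∘ enum3-swap₁₂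

enum3-from : ∀ i → ∃₂ (Enum3 i)
enum3-from 0F = _ , _ , e012
enum3-from 1F = _ , _ , e102
enum3-from 2F = _ , _ , e201

enum3-complete : ∀ {i j} → i ≢ j → ∃ (Enum3 i j)
enum3-complete {0F} {0F} i≢j = ⊥-elim (i≢j refl)
enum3-complete {0F} {1F} _ = _ , e012
enum3-complete {0F} {2F} _ = _ , e021
enum3-complete {1F} {0F} _ = _ , e102
enum3-complete {1F} {1F} i≢j = ⊥-elim (i≢j refl)
enum3-complete {1F} {2F} _ = _ , e120
enum3-complete {2F} {0F} _ = _ , e201
enum3-complete {2F} {1F} _ = _ , e210
enum3-complete {2F} {2F} i≢j = ⊥-elim (i≢j refl)

enum3-cover : ∀ {i j k} → Enum3 i j k → ∀ x → x ≡ i ⊎ x ≡ j ⊎ x ≡ k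
enum3-cover e012 0F = inj₁ refl
enum3-cover e012 1F = inj₂ (inj₁ refl)
enum3-cover e012 2F = inj₂ (inj₂ refl)
enum3-cover e021 0F = inj₁ refl
enum3-cover e021 1F = inj₂ (inj₂ refl)
enum3-cover e021 2F = inj₂ (inj₁ refl)
enum3-cover e102 0F = inj₂ (inj₁ refl)
enum3-cover e102 1F = inj₁ refl
enum3-cover e102 2F = inj₂ (inj₂ refl)
enum3-cover e120 0F = inj₂ (inj₂ refl)
enum3-cover e120 1F = inj₁ refl
enum3-cover e120 2F = inj₂ (inj₁ refl)
enum3-cover e201 0F = inj₂ (inj₁ refl)
enum3-cover e201 1F = inj₂ (inj₂ refl)
enum3-cover e201 2F = inj₁ refl
enum3-cover e210 0F = inj₂ (inj₂ refl)
enum3-cover e210 1F = inj₂ (inj₁ refl)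
enum3-cover e210 2F = inj₁ refl

enum3-sum : ∀ {i j k} → Enum3 i j k → (f : Fin 3 → ℕ) → f i + f j + f k ≡ f 0F + f 1F + f 2F
enum3-sum e012 f = refl
enum3-sum e021 f = xy∙z≈xz∙y (f 0F) (f 2F) (f 1F)
enum3-sum e102 f = xy∙z≈yx∙z (f 1F) (f 0F) (f 2F)
enum3-sum e120 f = trans (xy∙z≈xz∙y (f 1F) (f 2F) (f 0F)) (xy∙z≈yx∙z (f 1F) (f 0F) (f 2F))
enum3-sum e201 f = trans (xy∙z≈yx∙z (f 2F) (f 0F) (f 1F)) (xy∙z≈xz∙y (f 0F) (f 2F) (f 1F))
enum3-sum e210 f = trans (xy∙z≈xz∙y (f 2F) (f 1F) (f 0F)) (enum3-sum e201 f)

layer : ∀ {n} {A : Set} → (Vertex (suc n) → A) → Fin 3 → Vertex n → A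
layer f i t = f (i ∷ t)

count : ∀ n → (Vertex n → Bool) → ℕ
count zero p = if p [] then 1 else 0
count (suc n) p = count n (layer p 0F) + count n (layer p 1F) + count n (layer p 2F)

count-layers : ∀ {n i j k} → Enum3 i j k → (p : Vertex (suc n) → Bool) →
               count (suc n) p ≡ count n (layer p i) + count n (layer p j) + count n (layer p k)
count-layers e p = sym (enum3-sum e (count _ ∘ layer p))

count-layer≤ : ∀ {n} i (p : Vertex (suc n) → Bool) → count n (layer p i) ≤ count (suc n) p
count-layer≤ {n} i p with enum3-from i
... | _ , _ , e = begin
  count n (layer p i)                       ≤⟨ m≤m+n _ _ ⟩
  count n (layer p i) + _                   ≤⟨ m≤m+n _ _ ⟩
  count n (layer p i) + _ + _               ≡⟨ count-layers e p ⟨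
  count (suc n) p                           ∎
  where open ≤-Reasoning

count-cong : ∀ n {p q : Vertex n → Bool} → (∀ v → p v ≡ q v) → count n p ≡ count n q
count-cong zero p≗q rewrite p≗q [] = refl
count-cong (suc n) p≗q = cong₂ _+_ (cong₂ _+_ (count-cong n (p≗q ∘ (0F ∷_))) (count-cong n (p≗q ∘ (1F ∷_))))
                                   (count-cong n (p≗q ∘ (2F ∷_)))

count-mono : ∀ n {p q : Vertex n → Bool} → (∀ v → p v ≡ true → q v ≡ true) → count n p ≤ count n q
count-mono zero {p} p⇒q with p [] in p[]
... | false = z≤n
... | true rewrite p⇒q [] p[] = ≤-refl
count-mono (suc n) p⇒q = +-mono-≤ (+-mono-≤ (count-mono n (p⇒q ∘ (0F ∷_))) (count-mono n (p⇒q ∘ (1F ∷_))))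
                                  (count-mono n (p⇒q ∘ (2F ∷_)))

count-∨ : ∀ n (p q : Vertex n → Bool) → count n (λ v → p v ∨ q v) ≤ count n p + count n q
count-∨ zero p q with p [] | q []
... | true  | _     = s≤s z≤n
... | false | true  = ≤-refl
... | false | false = z≤n
count-∨ (suc n) p q = begin
  count (suc n) (λ v → p v ∨ q v)           ≤⟨ +-mono-≤ (+-mono-≤ (count-∨ n _ _) (count-∨ n _ _)) (count-∨ n _ _) ⟩
  (p₀ + q₀) + (p₁ + q₁) + (p₂ + q₂)         ≡⟨ +-interchange p₀ q₀ p₁ q₁ p₂ q₂ ⟩
  count (suc n) p + count (suc n) q         ∎
  where
  open ≤-Reasoning
  p₀ = count n (layer p 0F); p₁ = count n (layer p 1F); p₂ = count n (layer p 2F)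
  q₀ = count n (layer q 0F); q₁ = count n (layer q 1F); q₂ = count n (layer q 2F)
  +-interchange : ∀ a b c d e f → (a + b) + (c + d) + (e + f) ≡ (a + c + e) + (b + d + f)
  +-interchange = solve-∀

count-true : ∀ n → count n (λ _ → true) ≡ 3 ^ n
count-true zero = refl
count-true (suc n) rewrite count-true n = x+x+x≡3*x (3 ^ n)
  where
  x+x+x≡3*x : ∀ x → x + x + x ≡ 3 * x
  x+x+x≡3*x = solve-∀

count-≥1 : ∀ n (p : Vertex n → Bool) v → p v ≡ true → 1 ≤ count n p
count-≥1 zero p [] pv rewrite pv = ≤-refl
count-≥1 (suc n) p (x ∷ t) pv = ≤-trans (count-≥1 n (layer p x) t pv) (count-layer≤ x p)

count-≥2 : ∀ n (p : Vertex n → Bool) v w → v ≢ w → p v ≡ true → p w ≡ true → 2 ≤ count n p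
count-≥2 zero p [] [] v≢w _ _ = ⊥-elim (v≢w refl)
count-≥2 (suc n) p (x ∷ s) (y ∷ t) v≢w pv pw with x Fin.≟ y
... | yes refl = ≤-trans (count-≥2 n (layer p x) s t (v≢w ∘ cong (x ∷_)) pv pw) (count-layer≤ x p)
... | no x≢y with enum3-complete x≢y
...   | _ , e = begin
  2                                         ≤⟨ +-mono-≤ (count-≥1 n (layer p x) s pv) (count-≥1 n (layer p y) t pw) ⟩
  count n (layer p x) + count n (layer p y) ≤⟨ m≤m+n _ _ ⟩
  count n (layer p x) + count n (layer p y) + _ ≡⟨ count-layers e p ⟨
  count (suc n) p                           ∎
  where open ≤-Reasoning

count-cover : ∀ n (p q : Vertex n → Bool) → (∀ v → p v ≡ true ⊎ q v ≡ true) → 3 ^ n ≤ count n p + count n q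
count-cover n p q p∨q = begin
  3 ^ n                                     ≡⟨ count-true n ⟨
  count n (λ _ → true)                      ≤⟨ count-mono n (λ v _ → ∨-true (p∨q v)) ⟩
  count n (λ v → p v ∨ q v)                 ≤⟨ count-∨ n p q ⟩
  count n p + count n q                     ∎
  where
  open ≤-Reasoning
  ∨-true : ∀ {a b} → a ≡ true ⊎ b ≡ true → a ∨ b ≡ true
  ∨-true (inj₁ refl) = refl
  ∨-true {a} (inj₂ refl) = ∨-zeroʳ a

N[_] : ∀ {n} → Vertex n → Vertex n → Set
N[ t ] v = v ≡ t ⊎ t ~ v

N[]-tail : ∀ {n x} {t v : Vertex n} → N[ t ] v → N[ x ∷ t ] (x ∷ v)
N[]-tail (inj₁ refl) = inj₁ refl
N[]-tail (inj₂ t~v) = inj₂ (tail~ t~v)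

count-N[] : ∀ n (p : Vertex n → Bool) t → (∀ v → N[ t ] v → p v ≡ true) → suc (2 * n) ≤ count n p
count-N[] zero p [] N⊆p = count-≥1 zero p [] (N⊆p [] (inj₁ refl))
count-N[] (suc n) p (x ∷ t) N⊆p with enum3-from x
... | j , k , e = begin
  suc (2 * suc n)                           ≡⟨ solve (n List.∷ List.[]) ⟩
  suc (2 * n) + 1 + 1                       ≤⟨ +-mono-≤ (+-mono-≤ cₓ cⱼ) cₖ ⟩
  count n (layer p x) + count n (layer p j) + count n (layer p k) ≡⟨ count-layers e p ⟨
  count (suc n) p                           ∎
  where
  open ≤-Reasoning
  cₓ = count-N[] n (layer p x) t (λ v → N⊆p (x ∷ v) ∘ N[]-tail)
  cⱼ = count-≥1 n (layer p j) t (N⊆p (j ∷ t) (inj₂ (head≢ (enum3-≢ e))))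
  cₖ = count-≥1 n (layer p k) t (N⊆p (k ∷ t) (inj₂ (head≢ (enum3-≢₁₃ e))))

-- The closed neighbourhoods of two adjacent vertices share exactly three vertices, so their union has 4n − 1.
count-N[]∪N[] : ∀ n (p : Vertex n → Bool) {s t} → s ~ t → (∀ v → N[ s ] v ⊎ N[ t ] v → p v ≡ true) →
                4 * n ≤ suc (count n p)
count-N[]∪N[] (suc n) p (tail~ {x = x} {s} {t} s~t) N⊆p with enum3-from x
... | j , k , e = begin
  4 * suc n                                 ≡⟨ solve (n List.∷ List.[]) ⟩
  4 * n + 2 + 2                             ≤⟨ +-mono-≤ (+-mono-≤ cₓ cⱼ) cₖ ⟩
  suc (count n (layer p x) + count n (layer p j) + count n (layer p k)) ≡⟨ cong suc (count-layers e p) ⟨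
  suc (count (suc n) p)                     ∎
  where
  open ≤-Reasoning
  cₓ = count-N[]∪N[] n (layer p x) s~t (λ v → N⊆p (x ∷ v) ∘ Data.Sum.map N[]-tail N[]-tail)
  cross : ∀ {y} → x ≢ y → 2 ≤ count n (layer p y)
  cross x≢y = count-≥2 n _ s t (~⇒≢ s~t) (N⊆p _ (inj₁ (inj₂ (head≢ x≢y)))) (N⊆p _ (inj₂ (inj₂ (head≢ x≢y))))
  cⱼ = cross (enum3-≢ e)
  cₖ = cross (enum3-≢₁₃ e)
count-N[]∪N[] (suc n) p (head≢ {x = x} {y} {t} x≢y) N⊆p with enum3-complete x≢y
... | k , e = begin
  4 * suc n                                 ≡⟨ solve (n List.∷ List.[]) ⟩
  suc (suc (2 * n) + suc (2 * n) + 1)       ≤⟨ s≤s (+-mono-≤ (+-mono-≤ cₓ cᵧ) cₖ) ⟩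
  suc (count n (layer p x) + count n (layer p y) + count n (layer p k)) ≡⟨ cong suc (count-layers e p) ⟨
  suc (count (suc n) p)                     ∎
  where
  open ≤-Reasoning
  cₓ = count-N[] n (layer p x) t (λ v → N⊆p (x ∷ v) ∘ inj₁ ∘ N[]-tail)
  cᵧ = count-N[] n (layer p y) t (λ v → N⊆p (y ∷ v) ∘ inj₂ ∘ N[]-tail)
  cₖ = count-≥1 n (layer p k) t (N⊆p (k ∷ t) (inj₁ (inj₂ (head≢ (enum3-≢₁₃ e)))))

2n+1≤3^n : ∀ n → suc (2 * n) ≤ 3 ^ n
2n+1≤3^n zero = ≤-refl
2n+1≤3^n (suc n) = begin
  suc (2 * suc n)                           ≡⟨ solve (n List.∷ List.[]) ⟩
  suc (2 * n) + 1 + (1 + 0)                 ≤⟨ +-mono-≤ (+-mono-≤ (2n+1≤3^n n) 1≤3^n) (+-mono-≤ 1≤3^n z≤n) ⟩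
  3 ^ n + 3 ^ n + (3 ^ n + 0)               ≡⟨ +-assoc (3 ^ n) _ _ ⟩
  3 ^ suc n                                 ∎
  where
  open ≤-Reasoning
  1≤3^n = ≤-trans (s≤s z≤n) (2n+1≤3^n n)

4n≤1+3^n : ∀ n → 4 * n ≤ suc (3 ^ n)
4n≤1+3^n zero = z≤n
4n≤1+3^n (suc n) = begin
  4 * suc n                                 ≤⟨ m≤m+n _ (2 * n) ⟩
  4 * suc n + 2 * n                         ≡⟨ solve (n List.∷ List.[]) ⟩
  suc (3 * suc (2 * n))                     ≤⟨ s≤s (*-monoʳ-≤ 3 (2n+1≤3^n n)) ⟩
  suc (3 ^ suc n)                           ∎
  where open ≤-Reasoning

_≟ᵥ_ : ∀ {n} → DecidableEquality (Vertex n)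
_≟ᵥ_ = Vec.≡-dec Fin._≟_

_∈?_ : ∀ {n} (v : Vertex n) (S : List (Vertex n)) → Dec (v ∈ S)
v ∈? S = Any.any? (v ≟ᵥ_) S

count-false : ∀ n → count n (λ _ → false) ≡ 0
count-false zero = refl
count-false (suc n) rewrite count-false n = refl

count-≟ : ∀ n (x : Vertex n) → count n (λ v → does (v ≟ᵥ x)) ≡ 1
count-≟ zero [] = refl
count-≟ (suc n) (0F ∷ t) rewrite count-≟ n t | count-false n = refl
count-≟ (suc n) (1F ∷ t) rewrite count-≟ n t | count-false n = refl
count-≟ (suc n) (2F ∷ t) rewrite count-≟ n t | count-false n = refl

count-∈ : ∀ n (S : List (Vertex n)) → count n (λ v → does (v ∈? S)) ≤ length S
count-∈ n List.[] = ≤-reflexive (count-false n)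
count-∈ n (x List.∷ S) = ≤-trans (count-∨ n _ _) (+-mono-≤ (≤-reflexive (count-≟ n x)) (count-∈ n S))

data Side : Set where
  left right cut : Side

isCut : Side → Bool
isCut cut = true
isCut _   = false

isRight : Side → Bool
isRight right = true
isRight _     = false

flip : Side → Side
flip left  = right
flip right = left
flip cut   = cut

flip-involutive : ∀ σ → flip (flip σ) ≡ σ
flip-involutive left  = refl
flip-involutive right = refl
flip-involutive cut   = refl

flip-≡ : ∀ {σ τ} → flip σ ≡ τ → σ ≡ flip τ
flip-≡ {σ} refl = sym (flip-involutive σ)

isCut-flip : ∀ σ → isCut (flip σ) ≡ isCut σ
isCut-flip left  = refl
isCut-flip right = refl
isCut-flip cut   = refl

≢left,right⇒cut : ∀ {σ} → σ ≢ left → σ ≢ right → σ ≡ cut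
≢left,right⇒cut {left}  ≢l _   = ⊥-elim (≢l refl)
≢left,right⇒cut {right} _   ≢r = ⊥-elim (≢r refl)
≢left,right⇒cut {cut}   _   _  = refl

≢left⇒isCut∨isRight : ∀ {σ} → σ ≢ left → isCut σ ∨ isRight σ ≡ true
≢left⇒isCut∨isRight {left}  ≢l = ⊥-elim (≢l refl)
≢left⇒isCut∨isRight {right} _  = refl
≢left⇒isCut∨isRight {cut}   _  = refl

isRight⇒≡right : ∀ {σ} → isRight σ ≡ true → σ ≡ right
isRight⇒≡right {right} _ = refl

Labelling : ℕ → Set
Labelling n = Vertex n → Side

cutSize : ∀ {n} → Labelling n → ℕ
cutSize {n} ℓ = count n (isCut ∘ ℓ)

Separated : ∀ {n} → Labelling n → Set
Separated ℓ = ∀ {x y} → x ~ y → ℓ x ≡ left → ℓ y ≡ right → ⊥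

Supported : ∀ {n} → Side → Labelling n → Set
Supported {n} σ ℓ = ∀ x → ℓ x ≡ σ → ∃[ y ] x ~ y × ℓ y ≡ σ

Mixed : ∀ {n} → Labelling n → Set
Mixed ℓ = (∃[ a ] ℓ a ≡ left) × (∃[ b ] ℓ b ≡ right)

Avoids : ∀ {n} → Side → Labelling n → Set
Avoids σ ℓ = ∀ t → ℓ t ≢ σ

separated-layer : ∀ {n} {ℓ : Labelling (suc n)} i → Separated ℓ → Separated (layer ℓ i)
separated-layer i sep = sep ∘ tail~

next-to-left⇒cut : ∀ {n} {ℓ : Labelling n} {x y} → Separated ℓ → x ~ y → ℓ x ≡ left → ℓ y ≢ left → ℓ y ≡ cut
next-to-left⇒cut sep x~y ℓx ℓy≢l = ≢left,right⇒cut ℓy≢l (sep x~y ℓx)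

next-to-right⇒cut : ∀ {n} {ℓ : Labelling n} {x y} → Separated ℓ → x ~ y → ℓ y ≡ right → ℓ x ≢ right → ℓ x ≡ cut
next-to-right⇒cut sep x~y ℓy ℓx≢r = ≢left,right⇒cut (λ ℓx → sep x~y ℓx ℓy) ℓx≢r

cutSize-≥1 : ∀ {n} (ℓ : Labelling n) {t} → ℓ t ≡ cut → 1 ≤ cutSize ℓ
cutSize-≥1 {n} ℓ {t} ℓt = count-≥1 n (isCut ∘ ℓ) t (cong isCut ℓt)

cutSize-layers-≥ : ∀ {n} (ℓ : Labelling (suc n)) {i j k a c} → Enum3 i j k →
                   a ≤ cutSize (layer ℓ i) + cutSize (layer ℓ j) → c ≤ cutSize (layer ℓ k) → a + c ≤ cutSize ℓ
cutSize-layers-≥ ℓ e a≤ c≤ = ≤-trans (+-mono-≤ a≤ c≤) (≤-reflexive (sym (count-layers e (isCut ∘ ℓ))))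

separated-flip : ∀ {n} {ℓ : Labelling n} → Separated ℓ → Separated (flip ∘ ℓ)
separated-flip sep x~y ℓx ℓy = sep (~-sym x~y) (flip-≡ ℓy) (flip-≡ ℓx)

supported-flip : ∀ {n} {ℓ : Labelling n} {σ} → Supported σ ℓ → Supported (flip σ) (flip ∘ ℓ)
supported-flip {σ = σ} sup x ℓx with sup x (trans (flip-≡ ℓx) (flip-involutive σ))
... | y , x~y , ℓy = y , x~y , cong flip ℓy

avoids-flip : ∀ {n} {ℓ : Labelling n} {σ} → Avoids σ ℓ → Avoids (flip σ) (flip ∘ ℓ)
avoids-flip {σ = σ} av t ℓt = av t (trans (flip-≡ ℓt) (flip-involutive σ))

cutSize-flip : ∀ {n} (ℓ : Labelling n) → cutSize (flip ∘ ℓ) ≡ cutSize ℓ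
cutSize-flip {n} ℓ = count-cong n (isCut-flip ∘ ℓ)

_≟ₛ_ : DecidableEquality Side
left  ≟ₛ left  = yes refl
left  ≟ₛ right = no λ ()
left  ≟ₛ cut   = no λ ()
right ≟ₛ left  = no λ ()
right ≟ₛ right = yes refl
right ≟ₛ cut   = no λ ()
cut   ≟ₛ left  = no λ ()
cut   ≟ₛ right = no λ ()
cut   ≟ₛ cut   = yes refl

any-vertex? : ∀ {n} {P : Vertex n → Set} → (∀ v → Dec (P v)) → Dec (∃ P)
any-vertex? {zero} P? = map′ ([] ,_) (λ { ([] , p) → p }) (P? [])
any-vertex? {suc n} P? =
  map′ (λ (i , t , p) → i ∷ t , p) (λ { (i ∷ t , p) → i , t , p }) (Fin.any? λ i → any-vertex? (P? ∘ (i ∷_)))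

mixed-or-avoids : ∀ {n} (ℓ : Labelling n) → Mixed ℓ ⊎ Avoids left ℓ ⊎ Avoids right ℓ
mixed-or-avoids ℓ with any-vertex? (λ v → ℓ v ≟ₛ left) | any-vertex? (λ v → ℓ v ≟ₛ right)
... | yes hasLeft | yes hasRight = inj₁ (hasLeft , hasRight)
... | no noLeft   | _            = inj₂ (inj₁ (curry noLeft))
... | yes _       | no noRight   = inj₂ (inj₂ (curry noRight))

-- Walk from a to b correcting one coordinate at a time; along an edge the label cannot jump from left
-- to right.
cut-between : ∀ {n} {ℓ : Labelling n} → Separated ℓ → ∀ a b → ℓ a ≢ right → ℓ b ≢ left → ∃[ t ] ℓ t ≡ cut
cut-between sep [] [] ℓa≢r ℓb≢l = [] , ≢left,right⇒cut ℓb≢l ℓa≢r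
cut-between {ℓ = ℓ} sep (x ∷ a) (y ∷ b) ℓa≢r ℓb≢l with x Fin.≟ y
... | yes refl = let t , ℓt = cut-between (separated-layer x sep) a b ℓa≢r ℓb≢l in x ∷ t , ℓt
... | no x≢y with ℓ (x ∷ a) in ℓxa
...   | left  = let t , ℓt = cut-between (separated-layer y sep) a b (sep (head≢ x≢y) ℓxa) ℓb≢l in y ∷ t , ℓt
...   | right = ⊥-elim (ℓa≢r refl)
...   | cut   = x ∷ a , ℓxa

mixed-layer⇒cut : ∀ {n} {ℓ : Labelling (suc n)} {i j} → Separated ℓ → i ≢ j → Mixed (layer ℓ i) →
                  1 ≤ cutSize (layer ℓ j)
mixed-layer⇒cut {ℓ = ℓ} {j = j} sep i≢j ((a , ℓa) , (b , ℓb)) =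
  cutSize-≥1 (layer ℓ j) (proj₂ (cut-between (separated-layer j sep) a b
    (sep (head≢ i≢j) ℓa) (λ ℓjb → sep (head≢ (i≢j ∘ sym)) ℓjb ℓb)))

unmixed-layers : ∀ {n} {ℓ : Labelling (suc n)} {i j} → Separated ℓ → i ≢ j →
                 Avoids right (layer ℓ i) → Avoids left (layer ℓ j) →
                 3 ^ n ≤ cutSize (layer ℓ i) + cutSize (layer ℓ j)
unmixed-layers {n} {ℓ} {i} {j} sep i≢j noRightᵢ noLeftⱼ = count-cover n _ _ cover
  where
  cover : ∀ t → isCut (ℓ (i ∷ t)) ≡ true ⊎ isCut (ℓ (j ∷ t)) ≡ true
  cover t with ℓ (i ∷ t) in ℓit
  ... | cut   = inj₁ refl
  ... | right = ⊥-elim (noRightᵢ t ℓit)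
  ... | left  = inj₂ (cong isCut (next-to-left⇒cut sep (head≢ i≢j) ℓit (noLeftⱼ t)))

data LayerProfile {n} (ℓ : Labelling (suc n)) : Set where
  mixedLayer  : ∀ i → Mixed (layer ℓ i) → LayerProfile ℓ
  splitLayers : ∀ {i j k a b} → Enum3 i j k → Avoids right (layer ℓ i) → Avoids left (layer ℓ j) →
                ℓ (i ∷ a) ≡ left → ℓ (j ∷ b) ≡ right →
                Avoids left (layer ℓ k) ⊎ Avoids right (layer ℓ k) → LayerProfile ℓ

layerProfile : ∀ {n} {ℓ : Labelling (suc n)} → Mixed ℓ → LayerProfile ℓ
layerProfile {ℓ = ℓ} ((i ∷ a , ℓa) , (j ∷ b , ℓb)) with mixed-or-avoids (layer ℓ i)
... | inj₁ mixedᵢ            = mixedLayer i mixedᵢ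
... | inj₂ (inj₁ noLeftᵢ)    = ⊥-elim (noLeftᵢ a ℓa)
... | inj₂ (inj₂ noRightᵢ) with mixed-or-avoids (layer ℓ j)
...   | inj₁ mixedⱼ          = mixedLayer j mixedⱼ
...   | inj₂ (inj₂ noRightⱼ) = ⊥-elim (noRightⱼ b ℓb)
...   | inj₂ (inj₁ noLeftⱼ) with enum3-complete {i} {j} (λ { refl → noLeftⱼ a ℓa })
...     | k , e with mixed-or-avoids (layer ℓ k)
...       | inj₁ mixedₖ      = mixedLayer k mixedₖ
...       | inj₂ avoidsₖ     = splitLayers e noRightᵢ noLeftⱼ ℓa ℓb avoidsₖ

2n≤cutSize : ∀ n (ℓ : Labelling n) → Separated ℓ → Mixed ℓ → 2 * n ≤ cutSize ℓ
2n≤cutSize zero ℓ sep (([] , ℓa) , ([] , ℓb)) with () ← trans (sym ℓa) ℓb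
2n≤cutSize (suc n) ℓ sep mixed with layerProfile mixed
... | mixedLayer i mixedᵢ with enum3-from i
...   | _ , _ , e = begin
  2 * suc n                                 ≡⟨ solve (n List.∷ List.[]) ⟩
  2 * n + 1 + 1                             ≤⟨ cutSize-layers-≥ ℓ e (+-mono-≤ cᵢ cⱼ) cₖ ⟩
  cutSize ℓ                                 ∎
  where
  open ≤-Reasoning
  cᵢ = 2n≤cutSize n (layer ℓ i) (separated-layer i sep) mixedᵢ
  cⱼ = mixed-layer⇒cut sep (enum3-≢ e) mixedᵢ
  cₖ = mixed-layer⇒cut sep (enum3-≢₁₃ e) mixedᵢ
2n≤cutSize (suc n) ℓ sep mixed | splitLayers {k = k} {a} {b} e noRightᵢ noLeftⱼ ℓa ℓb avoidsₖ = begin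
  2 * suc n                                 ≡⟨ solve (n List.∷ List.[]) ⟩
  suc (2 * n) + 1                           ≤⟨ +-monoˡ-≤ 1 (2n+1≤3^n n) ⟩
  3 ^ n + 1                                 ≤⟨ cutSize-layers-≥ ℓ e (unmixed-layers sep (enum3-≢ e) noRightᵢ noLeftⱼ) cₖ ⟩
  cutSize ℓ                                 ∎
  where
  open ≤-Reasoning
  cₖ : 1 ≤ cutSize (layer ℓ k)
  cₖ = [ (λ noLeftₖ  → cutSize-≥1 (layer ℓ k) (next-to-left⇒cut sep (head≢ (enum3-≢₁₃ e)) ℓa (noLeftₖ a)))
       , (λ noRightₖ → cutSize-≥1 (layer ℓ k) (next-to-right⇒cut sep (head≢ (enum3-≢₂₃ e ∘ sym)) ℓb (noRightₖ b)))
       ] avoidsₖ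

partner-in-layer : ∀ {n} {ℓ : Labelling (suc n)} {σ i j k b} → Supported σ ℓ → Enum3 i j k →
                   Avoids σ (layer ℓ j) → Avoids σ (layer ℓ k) → ℓ (i ∷ b) ≡ σ → ∃[ y ] b ~ y × ℓ (i ∷ y) ≡ σ
partner-in-layer {i = i} {b = b} sup e noσⱼ noσₖ ℓb with sup (i ∷ b) ℓb
... | x ∷ y , i∷b~x∷y , ℓy with enum3-cover e x
...   | inj₂ (inj₁ refl) = ⊥-elim (noσⱼ y ℓy)
...   | inj₂ (inj₂ refl) = ⊥-elim (noσₖ y ℓy)
...   | inj₁ refl with i∷b~x∷y
...     | tail~ b~y  = y , b~y , ℓy
...     | head≢ i≢i = ⊥-elim (i≢i refl)

N[right]-≢left : ∀ {n} {ℓ : Labelling n} {t v} → Separated ℓ → ℓ t ≡ right → N[ t ] v → ℓ v ≢ left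
N[right]-≢left sep ℓt (inj₁ refl) ℓv with () ← trans (sym ℓv) ℓt
N[right]-≢left sep ℓt (inj₂ t~v) ℓv = sep (~-sym t~v) ℓv ℓt

via-flip : ∀ {n} (ℓ : Labelling n) {c} → c ≤ cutSize (flip ∘ ℓ) → c ≤ cutSize ℓ
via-flip ℓ c≤ = ≤-trans c≤ (≤-reflexive (cutSize-flip ℓ))

two-mixed-layers-bound : ∀ {n} (ℓ : Labelling (suc n)) {i j k} → Separated ℓ → Enum3 i j k →
                         Mixed (layer ℓ i) → Mixed (layer ℓ j) → suc (4 * n) ≤ cutSize ℓ
two-mixed-layers-bound {n} ℓ {i} {j} sep e mixedᵢ mixedⱼ = begin
  suc (4 * n)                               ≡⟨ solve (n List.∷ List.[]) ⟩
  2 * n + 2 * n + 1                         ≤⟨ cutSize-layers-≥ ℓ e (+-mono-≤ cᵢ cⱼ) cₖ ⟩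
  cutSize ℓ                                 ∎
  where
  open ≤-Reasoning
  cᵢ = 2n≤cutSize n (layer ℓ i) (separated-layer i sep) mixedᵢ
  cⱼ = 2n≤cutSize n (layer ℓ j) (separated-layer j sep) mixedⱼ
  cₖ = mixed-layer⇒cut sep (enum3-≢₁₃ e) mixedᵢ

mixed-and-split-bound : ∀ {n} (ℓ : Labelling (suc n)) {i j k} → Separated ℓ → Enum3 i j k →
                        Mixed (layer ℓ i) → Avoids right (layer ℓ j) → Avoids left (layer ℓ k) →
                        suc (4 * n) ≤ cutSize ℓ
mixed-and-split-bound {n} ℓ {i} sep e mixedᵢ noRightⱼ noLeftₖ = begin
  suc (4 * n)                               ≡⟨ solve (n List.∷ List.[]) ⟩
  suc (2 * n) + 2 * n                       ≤⟨ +-monoˡ-≤ (2 * n) (2n+1≤3^n n) ⟩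
  3 ^ n + 2 * n                             ≤⟨ cutSize-layers-≥ ℓ (enum3-swap₂₃ (enum3-swap₁₂ e))
                                                 (unmixed-layers sep (enum3-≢₂₃ e) noRightⱼ noLeftₖ)
                                                 (2n≤cutSize n (layer ℓ i) (separated-layer i sep) mixedᵢ) ⟩
  cutSize ℓ                                 ∎
  where open ≤-Reasoning

-- All right vertices lie in layer i and, being supported, contain an edge b–y there; the closed
-- neighbourhood of that edge in the layer has no left vertex, and every right vertex of layer i has a cut
-- vertex next to it in each of the other two layers.
single-right-layer-bound : ∀ {n} (ℓ : Labelling (suc n)) {i j k b} → Separated ℓ → Supported right ℓ →
                           Enum3 i j k → Avoids right (layer ℓ j) → Avoids right (layer ℓ k) →
                           ℓ (i ∷ b) ≡ right → suc (4 * n) ≤ cutSize ℓ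
single-right-layer-bound {n} ℓ {i} {b = b} sep supᵣ e noRightⱼ noRightₖ ℓb
  with partner-in-layer supᵣ e noRightⱼ noRightₖ ℓb
... | y , b~y , ℓy = ≤-trans (s≤s⁻¹ (begin
  suc (suc (4 * n))                         ≡⟨ +-comm 2 (4 * n) ⟩
  4 * n + 2                                 ≤⟨ +-mono-≤ N[b]∪N[y] rights≥2 ⟩
  suc (cutSize (layer ℓ i) + rights) + rights ∎))
  (cutSize-layers-≥ ℓ e (+-monoʳ-≤ (cutSize (layer ℓ i)) (rights≤cut (enum3-≢ e) noRightⱼ))
                        (rights≤cut (enum3-≢₁₃ e) noRightₖ))
  where
  open ≤-Reasoning
  rights = count n (isRight ∘ layer ℓ i)
  sepᵢ = separated-layer i sep
  N[b]∪N[y] : 4 * n ≤ suc (cutSize (layer ℓ i) + rights)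
  N[b]∪N[y] = ≤-trans (count-N[]∪N[] n (λ t → isCut (ℓ (i ∷ t)) ∨ isRight (ℓ (i ∷ t))) b~y λ v v∈N →
                        ≢left⇒isCut∨isRight ([ N[right]-≢left sepᵢ ℓb , N[right]-≢left sepᵢ ℓy ]′ v∈N))
                      (s≤s (count-∨ n _ _))
  rights≥2 : 2 ≤ rights
  rights≥2 = count-≥2 n _ b y (~⇒≢ b~y) (cong isRight ℓb) (cong isRight ℓy)
  rights≤cut : ∀ {x} → i ≢ x → Avoids right (layer ℓ x) → rights ≤ cutSize (layer ℓ x)
  rights≤cut i≢x noRightₓ = count-mono n λ t isRight-t →
    cong isCut (next-to-right⇒cut sep (head≢ (i≢x ∘ sym)) (isRight⇒≡right isRight-t) (noRightₓ t))

split-layers-bound : ∀ {n} (ℓ : Labelling (suc n)) {i j k b} → Separated ℓ → Supported right ℓ →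
                     Enum3 i j k → Avoids right (layer ℓ i) → Avoids left (layer ℓ j) → Avoids right (layer ℓ k) →
                     ℓ (j ∷ b) ≡ right → suc (4 * n) ≤ cutSize ℓ
split-layers-bound {n} ℓ {b = b} sep supᵣ e noRightᵢ noLeftⱼ noRightₖ ℓb
  with partner-in-layer supᵣ (enum3-swap₁₂ e) noRightᵢ noRightₖ ℓb
... | y , b~y , ℓy = begin
  suc (4 * n)                               ≤⟨ s≤s (4n≤1+3^n n) ⟩
  suc (suc (3 ^ n))                         ≡⟨ +-comm 2 (3 ^ n) ⟩
  3 ^ n + 2                                 ≤⟨ cutSize-layers-≥ ℓ e (unmixed-layers sep (enum3-≢ e) noRightᵢ noLeftⱼ)
                                                 (count-≥2 n _ b y (~⇒≢ b~y) (cut-below ℓb) (cut-below ℓy)) ⟩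
  cutSize ℓ                                 ∎
  where
  open ≤-Reasoning
  cut-below : ∀ {t} → ℓ (_ ∷ t) ≡ right → isCut (ℓ (_ ∷ t)) ≡ true
  cut-below {t} ℓt = cong isCut (next-to-right⇒cut sep (head≢ (enum3-≢₂₃ e ∘ sym)) ℓt (noRightₖ t))

mixed-layer-bound : ∀ {n} (ℓ : Labelling (suc n)) {i j k} → Separated ℓ → Supported left ℓ → Supported right ℓ →
                    Enum3 i j k → Mixed (layer ℓ i) → suc (4 * n) ≤ cutSize ℓ
mixed-layer-bound ℓ {i} {j} {k} sep supₗ supᵣ e mixedᵢ@((a , ℓa) , (b , ℓb))
  with mixed-or-avoids (layer ℓ j) | mixed-or-avoids (layer ℓ k)
... | inj₁ mixedⱼ           | _                    = two-mixed-layers-bound ℓ sep e mixedᵢ mixedⱼ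
... | inj₂ _                | inj₁ mixedₖ          = two-mixed-layers-bound ℓ sep (enum3-swap₂₃ e) mixedᵢ mixedₖ
... | inj₂ (inj₂ noRightⱼ)  | inj₂ (inj₁ noLeftₖ)  = mixed-and-split-bound ℓ sep e mixedᵢ noRightⱼ noLeftₖ
... | inj₂ (inj₁ noLeftⱼ)   | inj₂ (inj₂ noRightₖ) = mixed-and-split-bound ℓ sep (enum3-swap₂₃ e) mixedᵢ noRightₖ noLeftⱼ
... | inj₂ (inj₂ noRightⱼ)  | inj₂ (inj₂ noRightₖ) = single-right-layer-bound ℓ sep supᵣ e noRightⱼ noRightₖ ℓb
... | inj₂ (inj₁ noLeftⱼ)   | inj₂ (inj₁ noLeftₖ)  =
  via-flip ℓ (single-right-layer-bound (flip ∘ ℓ) (separated-flip sep) (supported-flip supₗ) e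
                (avoids-flip noLeftⱼ) (avoids-flip noLeftₖ) (cong flip ℓa))

4n+1≤cutSize : ∀ n (ℓ : Labelling (suc n)) → Separated ℓ → Supported left ℓ → Supported right ℓ → Mixed ℓ →
               suc (4 * n) ≤ cutSize ℓ
4n+1≤cutSize n ℓ sep supₗ supᵣ mixed with layerProfile mixed
... | mixedLayer i mixedᵢ = mixed-layer-bound ℓ sep supₗ supᵣ (proj₂ (proj₂ (enum3-from i))) mixedᵢ
... | splitLayers e noRightᵢ noLeftⱼ ℓa ℓb (inj₂ noRightₖ) = split-layers-bound ℓ sep supᵣ e noRightᵢ noLeftⱼ noRightₖ ℓb
... | splitLayers e noRightᵢ noLeftⱼ ℓa ℓb (inj₁ noLeftₖ) =
  via-flip ℓ (split-layers-bound (flip ∘ ℓ) (separated-flip sep) (supported-flip supₗ) (enum3-swap₁₂ e)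
                (avoids-flip noLeftⱼ) (avoids-flip noRightᵢ) (avoids-flip noLeftₖ) (cong flip ℓa))

first-step : ∀ {n} {S : List (Vertex n)} {x y} → Reach S x y → y ≢ x → ∃[ z ] x ~ z × z ∉ S
first-step (here _) y≢x = ⊥-elim (y≢x refl)
first-step {x = x} (step {w} {v} x⇝w w-v v∉S) v≢x with w ≟ᵥ x
... | yes refl = v , Adj⇒~ _ _ w-v , v∉S
... | no w≢x   = first-step x⇝w w≢x

outside-neighbour : ∀ {n} {S : List (Vertex n)} x → BigComponent 1 S x → ∃[ z ] x ~ z × z ∉ S
outside-neighbour x (c₁ ∷ c₂ ∷ _ , (c₁≢c₂ ∷ _) ∷ _ , x⇝c₁ ∷ x⇝c₂ ∷ _ , _) with c₁ ≟ᵥ x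
... | yes refl = first-step x⇝c₂ (c₁≢c₂ ∘ sym)
... | no c₁≢x  = first-step x⇝c₁ c₁≢x
outside-neighbour x (_ ∷ [] , _ , _ , s≤s ())

side : ∀ {A B : Set} → Dec A → Dec B → Side
side (yes _) _       = cut
side (no _)  (yes _) = left
side (no _)  (no _)  = right

side≡left : ∀ {A B : Set} (a? : Dec A) (b? : Dec B) → side a? b? ≡ left → ¬ A × B
side≡left (no ¬a) (yes b) _ = ¬a , b

side≡right : ∀ {A B : Set} (a? : Dec A) (b? : Dec B) → side a? b? ≡ right → ¬ A × ¬ B
side≡right (no ¬a) (no ¬b) _ = ¬a , ¬b

side-left : ∀ {A B : Set} (a? : Dec A) (b? : Dec B) → ¬ A → B → side a? b? ≡ left
side-left (yes a) _       ¬a _ = ⊥-elim (¬a a)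
side-left (no _)  (yes _) _  _ = refl
side-left (no _)  (no ¬b) _  b = ⊥-elim (¬b b)

side-right : ∀ {A B : Set} (a? : Dec A) (b? : Dec B) → ¬ A → ¬ B → side a? b? ≡ right
side-right (yes a) _       ¬a _  = ⊥-elim (¬a a)
side-right (no _)  (yes b) _  ¬b = ⊥-elim (¬b b)
side-right (no _)  (no _)  _  _  = refl

isCut-side : ∀ {A B : Set} (a? : Dec A) (b? : Dec B) → isCut (side a? b?) ≡ does a?
isCut-side (yes _) _       = refl
isCut-side (no _)  (yes _) = refl
isCut-side (no _)  (no _)  = refl

¬¬-decidable : ∀ n (P : Vertex n → Set) → ¬ ¬ (∀ v → Dec (P v))
¬¬-decidable zero P k = ¬¬-excluded-middle λ p? → k λ { [] → p? }
¬¬-decidable (suc n) P k =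
  ¬¬-decidable n (P ∘ (0F ∷_)) λ p₀? → ¬¬-decidable n (P ∘ (1F ∷_)) λ p₁? → ¬¬-decidable n (P ∘ (2F ∷_)) λ p₂? →
  k λ { (0F ∷ t) → p₀? t ; (1F ∷ t) → p₁? t ; (2F ∷ t) → p₂? t }

-- Reachability in Q_n^3 - S is only decided under a double negation, which is enough because the
-- conclusion is a decidable inequality.
extraCut-length : ∀ n (S : List (Vertex (suc n))) → IsExtraCut (suc n) 1 S → suc (4 * n) ≤ length S
extraCut-length n S (_ , (u , v , u∉S , v∉S , u⇸v) , big) =
  decidable-stable (_ ≤? _) λ ≰ → ¬¬-decidable (suc n) (Reach S u) (≰ ∘ bound)
  where
  bound : (∀ w → Dec (Reach S u w)) → suc (4 * n) ≤ length S
  bound reach? = begin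
    suc (4 * n)                             ≤⟨ 4n+1≤cutSize n ℓ separated supportedˡ supportedʳ mixed ⟩
    cutSize ℓ                               ≡⟨ count-cong (suc n) (λ w → isCut-side (w ∈? S) (reach? w)) ⟩
    count (suc n) (λ w → does (w ∈? S))     ≤⟨ count-∈ (suc n) S ⟩
    length S                                ∎
    where
    open ≤-Reasoning
    ℓ : Labelling (suc n)
    ℓ w = side (w ∈? S) (reach? w)
    separated : Separated ℓ
    separated {x} {y} x~y ℓx ℓy with side≡left (x ∈? S) (reach? x) ℓx | side≡right (y ∈? S) (reach? y) ℓy
    ... | _ , u⇝x | y∉S , u⇸y = u⇸y (step u⇝x (~⇒Adj x~y) y∉S)
    supportedˡ : Supported left ℓ
    supportedˡ x ℓx with side≡left (x ∈? S) (reach? x) ℓx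
    ... | x∉S , u⇝x with outside-neighbour x (big x x∉S)
    ...   | z , x~z , z∉S = z , x~z , side-left (z ∈? S) (reach? z) z∉S (step u⇝x (~⇒Adj x~z) z∉S)
    supportedʳ : Supported right ℓ
    supportedʳ x ℓx with side≡right (x ∈? S) (reach? x) ℓx
    ... | x∉S , u⇸x with outside-neighbour x (big x x∉S)
    ...   | z , x~z , z∉S = z , x~z , side-right (z ∈? S) (reach? z) z∉S
                                        (λ u⇝z → u⇸x (step u⇝z (~⇒Adj (~-sym x~z)) x∉S))
    mixed : Mixed ℓ
    mixed = (u , side-left (u ∈? S) (reach? u) u∉S (here u∉S)) , (v , side-right (v ∈? S) (reach? v) v∉S u⇸v)

origin : ∀ n → Vertex n
origin n = replicate n 0F

originNbrs : ∀ n → List (Vertex n)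
originNbrs zero    = []
originNbrs (suc n) = (1F ∷ origin n) ∷ (2F ∷ origin n) ∷ List.map (0F ∷_) (originNbrs n)

∈-originNbrs⁻ : ∀ {n t} → t ∈ originNbrs n → origin n ~ t
∈-originNbrs⁻ {suc n} (here refl)         = head≢ λ ()
∈-originNbrs⁻ {suc n} (there (here refl)) = head≢ λ ()
∈-originNbrs⁻ {suc n} (there (there p)) with ∈-map⁻ (0F ∷_) p
... | _ , q , refl = tail~ (∈-originNbrs⁻ q)

∈-originNbrs⁺ : ∀ {n t} → origin n ~ t → t ∈ originNbrs n
∈-originNbrs⁺ (head≢ {y = 0F} 0≢0) = ⊥-elim (0≢0 refl)
∈-originNbrs⁺ (head≢ {y = 1F} _)   = here refl
∈-originNbrs⁺ (head≢ {y = 2F} _)   = there (here refl)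
∈-originNbrs⁺ (tail~ o~t)          = there (there (∈-map⁺ (0F ∷_) (∈-originNbrs⁺ o~t)))

originNbrs-length : ∀ n → length (originNbrs n) ≡ 2 * n
originNbrs-length zero    = refl
originNbrs-length (suc n) = begin
  suc (suc (length (List.map (0F ∷_) (originNbrs n)))) ≡⟨ cong (2 +_) (length-map _ (originNbrs n)) ⟩
  suc (suc (length (originNbrs n)))          ≡⟨ cong (2 +_) (originNbrs-length n) ⟩
  suc (suc (2 * n))                          ≡⟨ solve (n List.∷ List.[]) ⟩
  2 * suc n                                  ∎
  where open ≡-Reasoning

∉-map-∷ : ∀ {n x y} {t : Vertex n} {L} → x ≢ y → x ∷ t ∉ List.map (y ∷_) L
∉-map-∷ {y = y} x≢y p with ∈-map⁻ (y ∷_) p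
... | _ , _ , refl = x≢y refl

unique-map-∷ : ∀ {n} x {L : List (Vertex n)} → Unique L → Unique (List.map (x ∷_) L)
unique-map-∷ x = Unique.map⁺ ∷-injectiveʳ

originNbrs-unique : ∀ n → Unique (originNbrs n)
originNbrs-unique zero    = []
originNbrs-unique (suc n) =
  ((λ ()) ∷ ¬Any⇒All¬ _ (∉-map-∷ λ ())) ∷ ¬Any⇒All¬ _ (∉-map-∷ λ ()) ∷ unique-map-∷ 0F (originNbrs-unique n)

-- The closed neighbourhood of the edge {0⋯0, 10⋯0} without the edge itself.
edgeCut : ∀ n → List (Vertex (suc n))
edgeCut n = (2F ∷ origin n) ∷ List.map (0F ∷_) (originNbrs n) List.++ List.map (1F ∷_) (originNbrs n)

data OnEdgeCut {n} : Vertex (suc n) → Set where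
  apex  : OnEdgeCut (2F ∷ origin n)
  side₀ : ∀ {t} → origin n ~ t → OnEdgeCut (0F ∷ t)
  side₁ : ∀ {t} → origin n ~ t → OnEdgeCut (1F ∷ t)

∈-edgeCut⁻ : ∀ {n v} → v ∈ edgeCut n → OnEdgeCut v
∈-edgeCut⁻ (here refl) = apex
∈-edgeCut⁻ {n} (there p) with ∈-++⁻ (List.map (0F ∷_) (originNbrs n)) p
... | inj₁ q with ∈-map⁻ (0F ∷_) q
...   | _ , r , refl = side₀ (∈-originNbrs⁻ r)
∈-edgeCut⁻ {n} (there p) | inj₂ q with ∈-map⁻ (1F ∷_) q
...   | _ , r , refl = side₁ (∈-originNbrs⁻ r)

∈-edgeCut⁺ : ∀ {n v} → OnEdgeCut v → v ∈ edgeCut n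
∈-edgeCut⁺ apex           = here refl
∈-edgeCut⁺ (side₀ o~t)    = there (∈-++⁺ˡ (∈-map⁺ (0F ∷_) (∈-originNbrs⁺ o~t)))
∈-edgeCut⁺ {n} (side₁ o~t) = there (∈-++⁺ʳ (List.map (0F ∷_) (originNbrs n)) (∈-map⁺ (1F ∷_) (∈-originNbrs⁺ o~t)))

edgeCut-length : ∀ n → length (edgeCut n) ≡ suc (4 * n)
edgeCut-length n = cong suc (begin
  length (List.map (0F ∷_) (originNbrs n) List.++ List.map (1F ∷_) (originNbrs n))
    ≡⟨ length-++ (List.map (0F ∷_) (originNbrs n)) ⟩
  length (List.map (0F ∷_) (originNbrs n)) + length (List.map (1F ∷_) (originNbrs n))
    ≡⟨ cong₂ _+_ (length-map _ (originNbrs n)) (length-map _ (originNbrs n)) ⟩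
  length (originNbrs n) + length (originNbrs n)
    ≡⟨ cong₂ _+_ (originNbrs-length n) (originNbrs-length n) ⟩
  2 * n + 2 * n
    ≡⟨ solve (n List.∷ List.[]) ⟩
  4 * n ∎)
  where open ≡-Reasoning

edgeCut-unique : ∀ n → Unique (edgeCut n)
edgeCut-unique n = ¬Any⇒All¬ _ apex∉ ∷ Unique.++⁺ (unique-map-∷ 0F (originNbrs-unique n))
                                                   (unique-map-∷ 1F (originNbrs-unique n)) disjoint
  where
  apex∉ : 2F ∷ origin n ∉ List.map (0F ∷_) (originNbrs n) List.++ List.map (1F ∷_) (originNbrs n)
  apex∉ p = [ ∉-map-∷ (λ ()) , ∉-map-∷ (λ ()) ]′ (∈-++⁻ (List.map (0F ∷_) (originNbrs n)) p)
  disjoint : ∀ {v} → ¬ (v ∈ List.map (0F ∷_) (originNbrs n) × v ∈ List.map (1F ∷_) (originNbrs n))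
  disjoint (p , q) with ∈-map⁻ (0F ∷_) p
  ... | _ , _ , refl = ∉-map-∷ (λ ()) q

onEdgeCut-below : ∀ {n x t} → x ≢ 2F → origin n ~ t → OnEdgeCut (x ∷ t)
onEdgeCut-below {x = 0F} _   = side₀
onEdgeCut-below {x = 1F} _   = side₁
onEdgeCut-below {x = 2F} x≢2 = ⊥-elim (x≢2 refl)

apex-∉-edgeCut : ∀ {n t} → t ≢ origin n → 2F ∷ t ∉ edgeCut n
apex-∉-edgeCut t≢o p with ∈-edgeCut⁻ p
... | apex = t≢o refl

edge-∉-edgeCut : ∀ {n x} → x ≢ 2F → x ∷ origin n ∉ edgeCut n
edge-∉-edgeCut x≢2 p with ∈-edgeCut⁻ p
... | apex      = x≢2 refl
... | side₀ o~o = ~-irrefl o~o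
... | side₁ o~o = ~-irrefl o~o

edge-component : ∀ {n w} → Reach (edgeCut n) (0F ∷ origin n) w → ∃[ x ] x ≢ 2F × w ≡ x ∷ origin n
edge-component (here _) = 0F , (λ ()) , refl
edge-component {n} (step {v = v} u⇝w w-v v∉) with edge-component u⇝w
... | x , x≢2 , refl with Adj⇒~ (x ∷ origin n) v w-v
...   | tail~ o~t       = ⊥-elim (v∉ (∈-edgeCut⁺ (onEdgeCut-below x≢2 o~t)))
...   | head≢ {y = y} _ = y , (λ { refl → v∉ (∈-edgeCut⁺ apex) }) , refl

edgeCut-outside-neighbour : ∀ n (w : Vertex (suc (suc n))) → ∃[ z ] w ~ z × z ∉ edgeCut (suc n)
edgeCut-outside-neighbour n (0F ∷ t) with t ≟ᵥ origin (suc n)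
... | yes refl = 1F ∷ t , head≢ (λ ()) , edge-∉-edgeCut (λ ())
... | no t≢o   = 2F ∷ t , head≢ (λ ()) , apex-∉-edgeCut t≢o
edgeCut-outside-neighbour n (1F ∷ t) with t ≟ᵥ origin (suc n)
... | yes refl = 0F ∷ t , head≢ (λ ()) , edge-∉-edgeCut (λ ())
... | no t≢o   = 2F ∷ t , head≢ (λ ()) , apex-∉-edgeCut t≢o
edgeCut-outside-neighbour n (2F ∷ 0F ∷ r) = 2F ∷ 1F ∷ r , tail~ (head≢ λ ()) , apex-∉-edgeCut λ ()
edgeCut-outside-neighbour n (2F ∷ 1F ∷ r) = 2F ∷ 2F ∷ r , tail~ (head≢ λ ()) , apex-∉-edgeCut λ ()
edgeCut-outside-neighbour n (2F ∷ 2F ∷ r) = 2F ∷ 1F ∷ r , tail~ (head≢ λ ()) , apex-∉-edgeCut λ ()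

edge⇒BigComponent : ∀ {n} {S : List (Vertex n)} {x z} → x ∉ S → x ~ z → z ∉ S → BigComponent 1 S x
edge⇒BigComponent x∉S x~z z∉S =
  _ ∷ _ ∷ [] , (~⇒≢ x~z ∷ []) ∷ [] ∷ [] , here x∉S ∷ step (here x∉S) (~⇒Adj x~z) z∉S ∷ [] , s≤s (s≤s z≤n)

edgeCut-isExtraCut : ∀ n → IsExtraCut (suc (suc n)) 1 (edgeCut (suc n))
edgeCut-isExtraCut n =
  edgeCut-unique (suc n) ,
  (0F ∷ origin (suc n) , 2F ∷ 1F ∷ origin n , edge-∉-edgeCut (λ ()) , apex-∉-edgeCut (λ ()) , disconnected) ,
  λ w w∉ → let z , w~z , z∉ = edgeCut-outside-neighbour n w in edge⇒BigComponent w∉ w~z z∉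
  where
  disconnected : ¬ Reach (edgeCut (suc n)) (0F ∷ origin (suc n)) (2F ∷ 1F ∷ origin n)
  disconnected u⇝v with edge-component u⇝v
  ... | _ , _ , ()

4[2+n]∸3≡1+4[1+n] : ∀ n → 4 * suc (suc n) ∸ 3 ≡ suc (4 * suc n)
4[2+n]∸3≡1+4[1+n] n = trans (cong (_∸ 3) 4[2+n]≡3+1+4[1+n]) (m+n∸m≡n 3 _)
  where
  4[2+n]≡3+1+4[1+n] : 4 * suc (suc n) ≡ 3 + suc (4 * suc n)
  4[2+n]≡3+1+4[1+n] = solve (n List.∷ List.[])

theorem6 : ∀ (n : ℕ) → 2 ≤ n → ExtraConnectivityIs n 1 (4 * n ∸ 3)
theorem6 (suc (suc n)) _ rewrite 4[2+n]∸3≡1+4[1+n] n =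
  (edgeCut (suc n) , edgeCut-isExtraCut n , edgeCut-length (suc n)) , extraCut-length (suc n)
theorem6 (suc zero) (s≤s ())
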